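{- Let $\mathcal H$ be an orientably regular hypermap with hypermap subgroup $H$ and chirality index $\kappa$, and let $\mathcal H_\Delta$ and $\mathcal H^\Delta$ be the orientably regular hypermaps with hypermap subgroups $H\cap H^r$ and $HH^r$ respectively. Then the coverings $\mathcal H_\Delta\to\mathcal H$ and $\mathcal H\to\mathcal H^\Delta$ are both regular $\kappa$-sheeted coverings whose covering transformation groups are isomorphic to the chirality group $X(\mathcal H)$. Moreover the covering $\mathcal H_\Delta\to\mathcal H$ is smooth.
   Context: Let $\Delta=\langle r_0,r_1,r_2\mid r_0^2=r_1^2=r_2^2=1\rangle$ and let $\Delta^+$ be its index-$2$ subgroup of even-length words, generated by $\rho=r_1r_2$ and $\lambda=r_2r_0$. An (oriented) hypermap is a triple $\mathcal H=(D,R,L)$ with $D$ a finite set and $R,L$ permutations of $D$ such that $\langle R,L\rangle$ is transitive on $D$; its type is $(m,n,k)$ where $m,n,k$ are the orders of $RL$, $R$, $L$. It is orientably regular if its automorphism group (permutations of $D$ commuting with $R$ and $L$) acts regularly on $D$; then $\mathcal H\cong(\Delta^+/H,\rho,\lambda)$ (left multiplication on cosets) for a unique normal subgroup $H$ of finite index in $\Delta^+$ (the hypermap subgroup). For normal subgroups $K\leq H$ of $\Delta^+$ the hypermap with subgroup $K$ covers the one with subgroup $H$ via $xK\mapsto xH$; such a covering is regular when $K\trianglelefteq H$, with covering transformation group $H/K$ and number of sheets $|H:K|$, and it is smooth if both hypermaps have the same type. For $H\trianglelefteq\Delta^+$ put $H^r=r_2Hr_2$. The chirality group is $X(\mathcal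 H)=HH^r/H$ (isomorphic to $H/(H\cap H^r)$) and the chirality index is $\kappa=|X(\mathcal H)|$. -}

module Defs where

open import Data.Nat using (ℕ; zero; suc; _<_; _≤_)
open import Data.Nat.Divisibility using (_∣_)
open import Data.Fin using (Fin) renaming (zero to f0; suc to fs)
open import Data.Fin.Properties using (_≟_)
open import Data.List using (List; []; _∷_; length; foldr; reverse; _++_)
open import Data.Product using (Σ; ∃; _×_; _,_)
open import Relation.Nullary using (yes; no)
open import Relation.Binary.PropositionalEquality using (_≡_)

-- The extended triangle group Δ = ⟨ r₀ , r₁ , r₂ | rᵢ² = 1 ⟩ (= C₂*C₂*C₂).
-- Elements are represented by words in the letters 0,1,2 (letter i = rᵢ),
-- with equality _≈_ given by free reduction modulo rᵢrᵢ = 1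
-- (two words are equal in Δ iff they have the same reduced normal form).

Word : Set
Word = List (Fin 3)

push : Fin 3 → Word → Word
push a [] = a ∷ []
push a (b ∷ v) with a ≟ b
... | yes _ = v
... | no _ = a ∷ b ∷ v

nf : Word → Word
nf = foldr push []

_≈_ : Word → Word → Set
u ≈ v = nf u ≡ nf v

_·_ : Word → Word → Word
u · v = u ++ v

infixl 7 _·_

-- inverse (each generator is an involution)
_⁻¹ : Word → Word
w ⁻¹ = reverse w

ε : Word
ε = []

_^_ : Word → ℕ → Word
g ^ zero = ε
g ^ suc m = g · (g ^ m)

r₀ r₁ r₂ : Word
r₀ = f0 ∷ []
r₁ = fs f0 ∷ []
r₂ = fs (fs f0) ∷ []

ρ lam : Word
ρ = r₁ · r₂
lam = r₂ · r₀

Pred : Set₁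
Pred = Word → Set

Δ⁺ : Pred
Δ⁺ w = 2 ∣ length w

_⊆_ : Pred → Pred → Set
A ⊆ B = ∀ {w} → A w → B w

_∩_ : Pred → Pred → Pred
(A ∩ B) w = A w × B w

_⋆_ : Pred → Pred → Pred
(A ⋆ B) w = Σ Word λ a → Σ Word λ b → A a × B b × (w ≈ (a · b))

_ʳ : Pred → Pred
(H ʳ) w = H (r₂ · w · r₂)

record IsSubgroup (A : Pred) : Set where
  field
    resp    : ∀ {u v} → u ≈ v → A u → A v
    has-ε   : A ε
    closed· : ∀ {u v} → A u → A v → A (u · v)
    closed⁻¹ : ∀ {u} → A u → A (u ⁻¹)

NormalIn : Pred → Pred → Set
NormalIn K G = ∀ {g k} → G g → K k → K ((g ⁻¹) · k · g)

-- |G : K| = n  (K ≤ G): a transversal t₀..t_{n-1} of the left cosets xK in G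
Index : Pred → Pred → ℕ → Set
Index K G n =
  Σ (Fin n → Word) λ t →
    (∀ i → G (t i)) ×
    (∀ i j → K ((t i ⁻¹) · t j) → i ≡ j) ×
    (∀ {g} → G g → Σ (Fin n) λ i → K ((t i ⁻¹) · g))

record IsHypermapSubgroup (H : Pred) : Set where
  field
    subgroup   : IsSubgroup H
    inΔ⁺       : H ⊆ Δ⁺
    normal     : NormalIn H Δ⁺
    finiteIndex : Σ ℕ λ n → Index H Δ⁺ n

-- An isomorphism of quotient groups G/K ≅ G'/K', given by a map on
-- representatives that is well defined, injective, a homomorphism and onto.
QuotIso : Pred → Pred → Pred → Pred → Set
QuotIso K G K' G' =
  Σ (Word → Word) λ f →
    (∀ {x} → G x → G' (f x)) ×
    (∀ {x y} → G x → G y →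
       (K ((x ⁻¹) · y) → K' ((f x ⁻¹) · f y)) ×
       (K' ((f x ⁻¹) · f y) → K ((x ⁻¹) · y))) ×
    (∀ {x y} → G x → G y → K' ((f (x · y) ⁻¹) · (f x · f y))) ×
    (∀ {y} → G' y → Σ Word λ x → G x × K' ((f x ⁻¹) · y))

-- left multiplication by g^m fixes every coset xH of Δ⁺/H
FixesCosets : Pred → Word → ℕ → Set
FixesCosets H g m = ∀ {x} → Δ⁺ x → H ((x ⁻¹) · ((g ^ m) · x))

PermOrder : Pred → Word → ℕ → Set
PermOrder H g m =
  (0 < m) × FixesCosets H g m × (∀ m' → 0 < m' → FixesCosets H g m' → m ≤ m')

-- the hypermap (Δ⁺/H, ρ, λ) has type (m, n, k): orders of RL, R, L
HasType : Pred → ℕ → ℕ → ℕ → Set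
HasType H m n k = PermOrder H (ρ · lam) m × PermOrder H ρ n × PermOrder H lam k

-- Δ is modelled by words modulo free reduction, which form a group because prepending a
-- letter is an involution on reduced words. Conjugation by r₂ is an automorphism of Δ⁺ of
-- order two, so H ∩ Hʳ and HHʳ are normal in Δ⁺, and x ↦ r₂xr₂ induces
-- H/(H ∩ Hʳ) ≅ Hʳ/(H ∩ Hʳ) ≅ HHʳ/H; hence |H : H ∩ Hʳ| = κ, and the tower law gives
-- |Δ⁺ : H ∩ Hʳ| = |Δ⁺ : H| κ. Membership in a subgroup of finite index is decidable, so
-- coset representatives of H in Δ⁺ can be pruned to a transversal of HHʳ. For smoothness,
-- r₂ maps each of ρ, λ, ρλ to a Δ⁺-conjugate of its inverse, so by normality a power of
-- it lies in H exactly when it lies in Hʳ.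

module Submission where

import Algebra.Properties.Group as GroupProperties
import Algebra.Solver.Monoid as MonoidSolver
open import Algebra.Bundles using (Group)
open import Data.Empty using (⊥-elim)
open import Data.Fin using (Fin; combine; remQuot) renaming (zero to f0; suc to fs)
open import Data.Fin.Properties using (_≟_; any?; remQuot-combine; combine-remQuot)
open import Data.List using ([]; _∷_; length; foldr; reverse)
open import Data.List.Properties
  using (++-assoc; ++-identityʳ; reverse-++; reverse-involutive; length-++; length-reverse; foldr-++; unfold-reverse)
open import Data.Nat using (ℕ; zero; suc; _+_; _*_; _%_)
open import Data.Nat.DivMod using ([m+n]%n≡m%n; %-distribˡ-+)
open import Data.Nat.Divisibility using (_∣_; divides; ∣m∣n⇒∣m+n; ∣m+n∣m⇒∣n; m%n≡0⇒n∣m; n∣m⇒m%n≡0)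
open import Data.Nat.Properties using (+-comm)
open import Data.Product using (Σ; _×_; _,_; proj₁; proj₂; uncurry)
open import Data.Sum using (_⊎_; inj₁; inj₂)
open import Data.Unit using (⊤; tt)
open import Function using (_∘_; _⇔_; mk⇔; Equivalence)
open import Function.Properties.Equivalence using () renaming (sym to ⇔-sym; trans to ⇔-trans)
open import Relation.Binary.Bundles using (Setoid)
open import Relation.Binary.PropositionalEquality
  using (_≡_; _≢_; refl; sym; trans; cong; cong₂; subst; module ≡-Reasoning)
import Relation.Binary.Reasoning.Setoid as ≃-Reasoning
open import Relation.Binary.Structures using (IsEquivalence)
open import Relation.Nullary using (Dec; yes; no; contradiction)
open import Relation.Nullary.Decidable using (map′)

open import Defs

open Equivalence using (to; from)

-- Free reduction

Reduced : Word → Set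
Reduced []          = ⊤
Reduced (_ ∷ [])    = ⊤
Reduced (a ∷ b ∷ w) = a ≢ b × Reduced (b ∷ w)

reduced-tail : ∀ {a w} → Reduced (a ∷ w) → Reduced w
reduced-tail {w = []}    _       = tt
reduced-tail {w = _ ∷ _} (_ , r) = r

push-reduced : ∀ a {w} → Reduced w → Reduced (push a w)
push-reduced a {[]}    _ = tt
push-reduced a {b ∷ w} r with a ≟ b
... | yes _  = reduced-tail r
... | no a≢b = a≢b , r

push-involutive : ∀ a {w} → Reduced w → push a (push a w) ≡ w
push-involutive a {[]} _ with a ≟ a
... | yes _  = refl
... | no a≢a = contradiction refl a≢a
push-involutive a {b ∷ w} r with a ≟ b
push-involutive a {b ∷ []}    _       | yes refl = refl
push-involutive a {b ∷ c ∷ w} (b≢c , _) | yes refl with a ≟ c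
... | yes a≡c = contradiction a≡c b≢c
... | no _    = refl
push-involutive a {b ∷ w} _ | no _ with a ≟ a
... | yes _  = refl
... | no a≢a = contradiction refl a≢a

pushAll : Word → Word → Word
pushAll u w = foldr push w u

nf-· : ∀ u v → nf (u · v) ≡ pushAll u (nf v)
nf-· u v = foldr-++ push [] u v

pushAll-reduced : ∀ u {w} → Reduced w → Reduced (pushAll u w)
pushAll-reduced []      r = r
pushAll-reduced (a ∷ u) r = push-reduced a (pushAll-reduced u r)

nf-reduced : ∀ u → Reduced (nf u)
nf-reduced u = pushAll-reduced u {[]} tt

pushAll-push : ∀ a v {w} → Reduced w → pushAll (push a v) w ≡ push a (pushAll v w)
pushAll-push a []      r = refl
pushAll-push a (b ∷ v) r with a ≟ b
... | yes refl = sym (push-involutive a (pushAll-reduced v r))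
... | no _     = refl

pushAll-nf : ∀ u {w} → Reduced w → pushAll u w ≡ pushAll (nf u) w
pushAll-nf []      r = refl
pushAll-nf (a ∷ u) r = trans (cong (push a) (pushAll-nf u r)) (sym (pushAll-push a (nf u) r))

pushAll-reverse : ∀ u {w} → Reduced w → pushAll (reverse u) (pushAll u w) ≡ w
pushAll-reverse []      r = refl
pushAll-reverse (a ∷ u) {w} r = begin
  pushAll (reverse (a ∷ u)) (push a (pushAll u w))   ≡⟨ cong (λ v → pushAll v (push a (pushAll u w))) (unfold-reverse a u) ⟩
  pushAll (reverse u · (a ∷ [])) (push a (pushAll u w)) ≡⟨ foldr-++ push (push a (pushAll u w)) (reverse u) (a ∷ []) ⟩
  pushAll (reverse u) (push a (push a (pushAll u w))) ≡⟨ cong (pushAll (reverse u)) (push-involutive a (pushAll-reduced u r)) ⟩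
  pushAll (reverse u) (pushAll u w)                   ≡⟨ pushAll-reverse u r ⟩
  w                                                   ∎
  where open ≡-Reasoning

-- Defs._≈_ unfolds to an equation between normal forms, from which the compared
-- words cannot be inferred; the record wrapper keeps them visible to unification.
record _≃_ (u v : Word) : Set where
  constructor ≈⇒≃
  field ≃⇒≈ : u ≈ v
open _≃_

infix 4 _≃_

≡⇒≃ : ∀ {u v} → u ≡ v → u ≃ v
≡⇒≃ u≡v = ≈⇒≃ (cong nf u≡v)

·-cong : ∀ {u u′ v v′} → u ≃ u′ → v ≃ v′ → u · v ≃ u′ · v′
·-cong {u} {u′} {v} {v′} (≈⇒≃ u≈u′) (≈⇒≃ v≈v′) = ≈⇒≃ (begin
  nf (u · v)                ≡⟨ nf-· u v ⟩
  pushAll u (nf v)          ≡⟨ pushAll-nf u (nf-reduced v) ⟩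
  pushAll (nf u) (nf v)     ≡⟨ cong₂ pushAll u≈u′ v≈v′ ⟩
  pushAll (nf u′) (nf v′)   ≡⟨ pushAll-nf u′ (nf-reduced v′) ⟨
  pushAll u′ (nf v′)        ≡⟨ nf-· u′ v′ ⟨
  nf (u′ · v′)              ∎)
  where open ≡-Reasoning

·-inverseˡ : ∀ u → u ⁻¹ · u ≃ ε
·-inverseˡ u = ≈⇒≃ (trans (nf-· (reverse u) u) (pushAll-reverse u {[]} tt))

·-inverseʳ : ∀ u → u · u ⁻¹ ≃ ε
·-inverseʳ u = subst (λ v → v · u ⁻¹ ≃ ε) (reverse-involutive u) (·-inverseˡ (u ⁻¹))

≃-isEquivalence : IsEquivalence _≃_
≃-isEquivalence = record
  { refl  = ≈⇒≃ refl
  ; sym   = λ (≈⇒≃ p) → ≈⇒≃ (sym p)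
  ; trans = λ (≈⇒≃ p) (≈⇒≃ q) → ≈⇒≃ (trans p q)
  }

open IsEquivalence ≃-isEquivalence
  using () renaming (refl to ≃-refl; sym to ≃-sym; trans to ≃-trans)

≃-setoid : Setoid _ _
≃-setoid = record { isEquivalence = ≃-isEquivalence }

·-congˡ : ∀ u {v v′} → v ≃ v′ → u · v ≃ u · v′
·-congˡ u = ·-cong (≃-refl {u})

·-congʳ : ∀ {u u′} → u ≃ u′ → ∀ v → u · v ≃ u′ · v
·-congʳ u≃u′ v = ·-cong u≃u′ (≃-refl {v})

⁻¹-cong : ∀ {u v} → u ≃ v → u ⁻¹ ≃ v ⁻¹
⁻¹-cong {u} {v} u≃v = begin
  u ⁻¹                ≈⟨ ≡⇒≃ (++-identityʳ (u ⁻¹)) ⟨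
  u ⁻¹ · ε            ≈⟨ ·-congˡ (u ⁻¹) (·-inverseʳ v) ⟨
  u ⁻¹ · (v · v ⁻¹)   ≈⟨ ·-congˡ (u ⁻¹) (·-congʳ (≃-sym u≃v) (v ⁻¹)) ⟩
  u ⁻¹ · (u · v ⁻¹)   ≈⟨ ≡⇒≃ (++-assoc (u ⁻¹) u (v ⁻¹)) ⟨
  u ⁻¹ · u · v ⁻¹     ≈⟨ ·-congʳ (·-inverseˡ u) (v ⁻¹) ⟩
  v ⁻¹                ∎
  where open ≃-Reasoning ≃-setoid

Δ-group : Group _ _
Δ-group = record
  { Carrier = Word
  ; _≈_     = _≃_
  ; _∙_     = _·_
  ; ε       = ε
  ; _⁻¹     = _⁻¹
  ; isGroup = record
    { isMonoid = record
      { isSemigroup = record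
        { isMagma = record { isEquivalence = ≃-isEquivalence ; ∙-cong = ·-cong }
        ; assoc   = λ u v w → ≡⇒≃ (++-assoc u v w)
        }
      ; identity = (λ _ → ≈⇒≃ refl) , (λ u → ≡⇒≃ (++-identityʳ u))
      }
    ; inverse = ·-inverseˡ , ·-inverseʳ
    ; ⁻¹-cong = ⁻¹-cong
    }
  }

open Group Δ-group using (assoc; identityʳ; inverseˡ)
open GroupProperties Δ-group using (\\-leftDividesˡ; \\-leftDividesʳ; //-rightDividesʳ)
open MonoidSolver (Group.monoid Δ-group) using (solve; _⊜_; _⊕_)

-- The even subgroup Δ⁺

length-push-mod2 : ∀ a w → length (push a w) % 2 ≡ suc (length w) % 2
length-push-mod2 a []      = refl
length-push-mod2 a (b ∷ w) with a ≟ b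
... | yes _ = trans (sym ([m+n]%n≡m%n (length w) 2)) (cong (_% 2) (+-comm (length w) 2))
... | no _  = refl

length-nf-mod2 : ∀ w → length (nf w) % 2 ≡ length w % 2
length-nf-mod2 []      = refl
length-nf-mod2 (a ∷ w) = begin
  length (push a (nf w)) % 2        ≡⟨ length-push-mod2 a (nf w) ⟩
  (1 + length (nf w)) % 2           ≡⟨ %-distribˡ-+ 1 (length (nf w)) 2 ⟩
  (1 + length (nf w) % 2) % 2       ≡⟨ cong (λ r → (1 + r) % 2) (length-nf-mod2 w) ⟩
  (1 + length w % 2) % 2            ≡⟨ %-distribˡ-+ 1 (length w) 2 ⟨
  (1 + length w) % 2                ∎
  where open ≡-Reasoning

Δ⁺-resp : ∀ {u v} → u ≈ v → Δ⁺ u → Δ⁺ v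
Δ⁺-resp {u} {v} u≈v 2∣u = m%n≡0⇒n∣m (length v) 2 (begin
  length v % 2       ≡⟨ length-nf-mod2 v ⟨
  length (nf v) % 2  ≡⟨ cong (λ w → length w % 2) u≈v ⟨
  length (nf u) % 2  ≡⟨ length-nf-mod2 u ⟩
  length u % 2       ≡⟨ n∣m⇒m%n≡0 (length u) 2 2∣u ⟩
  0                  ∎)
  where open ≡-Reasoning

Δ⁺-isSubgroup : IsSubgroup Δ⁺
Δ⁺-isSubgroup = record
  { resp     = λ {u} {v} → Δ⁺-resp {u} {v}
  ; has-ε    = divides 0 refl
  ; closed·  = λ {u} 2∣u 2∣v → subst (2 ∣_) (sym (length-++ u)) (∣m∣n⇒∣m+n 2∣u 2∣v)
  ; closed⁻¹ = λ {u} → subst (2 ∣_) (sym (length-reverse u))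
  }

length-reflect : ∀ u → length (r₂ · u · r₂) ≡ 2 + length u
length-reflect u = cong suc (trans (length-++ u) (+-comm (length u) 1))

Δ⁺-reflect : ∀ u → Δ⁺ u → Δ⁺ (r₂ · u · r₂)
Δ⁺-reflect u 2∣u = subst (2 ∣_) (sym (length-reflect u)) (∣m∣n⇒∣m+n (divides 1 refl) 2∣u)

Δ⁺-unreflect : ∀ u → Δ⁺ (r₂ · u · r₂) → Δ⁺ u
Δ⁺-unreflect u 2∣r₂ur₂ = ∣m+n∣m⇒∣n (subst (2 ∣_) (length-reflect u) 2∣r₂ur₂) (divides 1 refl)

-- Subgroups, conjugation and the reflection

module Subgroup {K : Pred} (K-sub : IsSubgroup K) where
  open IsSubgroup K-sub public

  resp≃ : ∀ {u v} → u ≃ v → K u → K v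
  resp≃ = resp ∘ ≃⇒≈

  coset-refl : ∀ x → K (x ⁻¹ · x)
  coset-refl x = resp≃ (≃-sym (inverseˡ x)) has-ε

  coset-sym : ∀ {x y} → K (x ⁻¹ · y) → K (y ⁻¹ · x)
  coset-sym {x} {y} = subst K (trans (reverse-++ (x ⁻¹) y) (cong (y ⁻¹ ·_) (reverse-involutive x))) ∘ closed⁻¹

  coset-trans : ∀ {x y z} → K (x ⁻¹ · y) → K (y ⁻¹ · z) → K (x ⁻¹ · z)
  coset-trans {x} {y} {z} k l =
    resp≃ (≃-trans (assoc (x ⁻¹) y (y ⁻¹ · z)) (·-congˡ (x ⁻¹) (\\-leftDividesˡ y z))) (closed· k l)

  coset-member : ∀ {x y} → K x → K (x ⁻¹ · y) → K y
  coset-member {x} {y} k l = resp≃ (\\-leftDividesˡ x y) (closed· k l)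

  coset-right : ∀ x {y} → K y → K (x ⁻¹ · (x · y))
  coset-right x {y} = resp≃ (≃-sym (\\-leftDividesʳ x y))

  member-coset : ∀ {x y} → K x → K y → K (x ⁻¹ · y)
  member-coset k l = closed· (closed⁻¹ k) l

  ⁻¹-member : ∀ {x} → K (x ⁻¹) → K x
  ⁻¹-member {x} = subst K (reverse-involutive x) ∘ closed⁻¹

conj : Word → Word → Word
conj c x = c ⁻¹ · x · c

conj-cong : ∀ c {x y} → x ≃ y → conj c x ≃ conj c y
conj-cong c x≃y = ·-congʳ (·-congˡ (c ⁻¹) x≃y) c

conj-ε : ∀ c → conj c ε ≃ ε
conj-ε c = ≃-trans (≡⇒≃ (cong (_· c) (++-identityʳ (c ⁻¹)))) (inverseˡ c)

conj-· : ∀ c x y → conj c (x · y) ≃ conj c x · conj c y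
conj-· c x y = begin
  c ⁻¹ · (x · y) · c                ≈⟨ ·-congʳ (·-congˡ (c ⁻¹) (·-congʳ (//-rightDividesʳ c x) y)) c ⟨
  c ⁻¹ · (x · c · c ⁻¹ · y) · c     ≈⟨ reassociate c (c ⁻¹) x y ⟩
  (c ⁻¹ · x · c) · (c ⁻¹ · y · c)   ∎
  where
  open ≃-Reasoning ≃-setoid
  reassociate : ∀ c c′ x y → c′ · (x · c · c′ · y) · c ≃ (c′ · x · c) · (c′ · y · c)
  reassociate = solve 4
    (λ c c′ x y → (c′ ⊕ (((x ⊕ c) ⊕ c′) ⊕ y)) ⊕ c ⊜ ((c′ ⊕ x) ⊕ c) ⊕ ((c′ ⊕ y) ⊕ c)) ≃-refl

conj-⁻¹ : ∀ c x → conj c (x ⁻¹) ≡ conj c x ⁻¹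
conj-⁻¹ c x = sym (begin
  (c ⁻¹ · x · c) ⁻¹          ≡⟨ reverse-++ (c ⁻¹ · x) c ⟩
  c ⁻¹ · (c ⁻¹ · x) ⁻¹       ≡⟨ cong (c ⁻¹ ·_) (reverse-++ (c ⁻¹) x) ⟩
  c ⁻¹ · (x ⁻¹ · c ⁻¹ ⁻¹)    ≡⟨ cong (λ d → c ⁻¹ · (x ⁻¹ · d)) (reverse-involutive c) ⟩
  c ⁻¹ · (x ⁻¹ · c)          ≡⟨ ++-assoc (c ⁻¹) (x ⁻¹) c ⟨
  c ⁻¹ · x ⁻¹ · c            ∎)
  where open ≡-Reasoning

conj-conj : ∀ c g k → conj c (conj g k) ≃ conj (conj c g) (conj c k)
conj-conj c g k = begin
  conj c (g ⁻¹ · k · g)                  ≈⟨ conj-· c (g ⁻¹ · k) g ⟩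
  conj c (g ⁻¹ · k) · conj c g           ≈⟨ ·-congʳ (conj-· c (g ⁻¹) k) (conj c g) ⟩
  conj c (g ⁻¹) · conj c k · conj c g    ≡⟨ cong (λ h → h · conj c k · conj c g) (conj-⁻¹ c g) ⟩
  conj c g ⁻¹ · conj c k · conj c g      ∎
  where open ≃-Reasoning ≃-setoid

^-cong : ∀ m {g h} → g ≃ h → g ^ m ≃ h ^ m
^-cong zero    g≃h = ≃-refl
^-cong (suc m) g≃h = ·-cong g≃h (^-cong m g≃h)

^-comm : ∀ g m → g ^ m · g ≡ g · g ^ m
^-comm g zero    = sym (++-identityʳ g)
^-comm g (suc m) = trans (++-assoc g (g ^ m) g) (cong (g ·_) (^-comm g m))

⁻¹-^ : ∀ g m → (g ⁻¹) ^ m ≃ (g ^ m) ⁻¹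
⁻¹-^ g zero    = ≃-refl
⁻¹-^ g (suc m) = ≃-trans (·-congˡ (g ⁻¹) (⁻¹-^ g m))
  (≡⇒≃ (sym (trans (cong _⁻¹ (sym (^-comm g m))) (reverse-++ (g ^ m) g))))

conj-^ : ∀ c g m → conj c (g ^ m) ≃ conj c g ^ m
conj-^ c g zero    = conj-ε c
conj-^ c g (suc m) = ≃-trans (conj-· c g (g ^ m)) (·-congˡ (conj c g) (conj-^ c g m))

-- r₂ ⁻¹ computes to r₂, so (H ʳ) w is definitionally H (reflect w).
reflect : Word → Word
reflect = conj r₂

reflect-involutive : ∀ x → reflect (reflect x) ≃ x
reflect-involutive x = begin
  r₂ · (r₂ · x · r₂) · r₂      ≡⟨ cong (r₂ · r₂ ·_) (++-assoc x r₂ r₂) ⟩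
  r₂ · r₂ · x · (r₂ · r₂)      ≈⟨ ·-cong (·-congʳ (inverseˡ r₂) x) (inverseˡ r₂) ⟩
  x · ε                        ≈⟨ identityʳ x ⟩
  x                            ∎
  where open ≃-Reasoning ≃-setoid

-- Normal subgroups of Δ⁺

record IsNormalSubgroupOfΔ⁺ (N : Pred) : Set where
  field
    subgroup : IsSubgroup N
    inΔ⁺     : N ⊆ Δ⁺
    normal   : NormalIn N Δ⁺

module NormalSubgroupOfΔ⁺ {N : Pred} (N◁ : IsNormalSubgroupOfΔ⁺ N) where
  open IsNormalSubgroupOfΔ⁺ N◁ public
  open Subgroup subgroup public

normalIn : ∀ {N G} → IsNormalSubgroupOfΔ⁺ N → G ⊆ Δ⁺ → NormalIn N G
normalIn N◁ G⊆Δ⁺ {g} {k} = IsNormalSubgroupOfΔ⁺.normal N◁ {g} {k} ∘ G⊆Δ⁺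

∩-isNormalSubgroupOfΔ⁺ : ∀ {A B} → IsNormalSubgroupOfΔ⁺ A → IsNormalSubgroupOfΔ⁺ B → IsNormalSubgroupOfΔ⁺ (A ∩ B)
∩-isNormalSubgroupOfΔ⁺ {A} {B} A◁ B◁ = record
  { subgroup = record
    { resp     = λ u≈v (a , b) → A.resp u≈v a , B.resp u≈v b
    ; has-ε    = A.has-ε , B.has-ε
    ; closed·  = λ (a , b) (a′ , b′) → A.closed· a a′ , B.closed· b b′
    ; closed⁻¹ = λ (a , b) → A.closed⁻¹ a , B.closed⁻¹ b
    }
  ; inΔ⁺   = λ {w} → A.inΔ⁺ {w} ∘ proj₁
  ; normal = λ {g} {k} g∈Δ⁺ (a , b) → A.normal {g} {k} g∈Δ⁺ a , B.normal {g} {k} g∈Δ⁺ b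
  }
  where
  module A = NormalSubgroupOfΔ⁺ A◁
  module B = NormalSubgroupOfΔ⁺ B◁

⋆-isNormalSubgroupOfΔ⁺ : ∀ {A B} → IsNormalSubgroupOfΔ⁺ A → IsNormalSubgroupOfΔ⁺ B → IsNormalSubgroupOfΔ⁺ (A ⋆ B)
⋆-isNormalSubgroupOfΔ⁺ {A} {B} A◁ B◁ = record
  { subgroup = record
    { resp     = λ u≈v (a , b , a∈A , b∈B , u≈ab) → a , b , a∈A , b∈B , trans (sym u≈v) u≈ab
    ; has-ε    = ε , ε , A.has-ε , B.has-ε , refl
    ; closed·  = λ {u} {v} (a , b , a∈A , b∈B , u≈ab) (c , d , c∈A , d∈B , v≈cd) →
        a · c , conj c b · d , A.closed· a∈A c∈A , B.closed· (B.normal {c} {b} (A.inΔ⁺ {c} c∈A) b∈B) d∈B ,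
        ≃⇒≈ (≃-trans (·-cong (≈⇒≃ {u} {a · b} u≈ab) (≈⇒≃ {v} {c · d} v≈cd)) (·-swap-conj a b c d))
    ; closed⁻¹ = λ {u} (a , b , a∈A , b∈B , u≈ab) →
        conj b (a ⁻¹) , b ⁻¹ , A.normal {b} {a ⁻¹} (B.inΔ⁺ {b} b∈B) (A.closed⁻¹ a∈A) , B.closed⁻¹ b∈B ,
        ≃⇒≈ (≃-trans (⁻¹-cong (≈⇒≃ {u} {a · b} u≈ab)) (⁻¹-swap-conj a b))
    }
  ; inΔ⁺   = λ {w} (a , b , a∈A , b∈B , w≈ab) →
      Δ⁺-resp {a · b} {w} (sym w≈ab) (IsSubgroup.closed· Δ⁺-isSubgroup {a} {b} (A.inΔ⁺ {a} a∈A) (B.inΔ⁺ {b} b∈B))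
  ; normal = λ {g} {k} g∈Δ⁺ (a , b , a∈A , b∈B , k≈ab) →
      conj g a , conj g b , A.normal {g} {a} g∈Δ⁺ a∈A , B.normal {g} {b} g∈Δ⁺ b∈B ,
      ≃⇒≈ (≃-trans (conj-cong g (≈⇒≃ {k} {a · b} k≈ab)) (conj-· g a b))
  }
  where
  module A = NormalSubgroupOfΔ⁺ A◁
  module B = NormalSubgroupOfΔ⁺ B◁

  ·-swap-conj : ∀ a b c d → a · b · (c · d) ≃ a · c · (conj c b · d)
  ·-swap-conj a b c d = begin
    a · b · (c · d)               ≈⟨ ·-congʳ (·-congʳ (//-rightDividesʳ c a) b) (c · d) ⟨
    a · c · c ⁻¹ · b · (c · d)    ≈⟨ reassociate a b c (c ⁻¹) d ⟩
    a · c · (conj c b · d)        ∎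
    where
    open ≃-Reasoning ≃-setoid
    reassociate : ∀ a b c c′ d → a · c · c′ · b · (c · d) ≃ a · c · (c′ · b · c · d)
    reassociate = solve 5
      (λ a b c c′ d → (((a ⊕ c) ⊕ c′) ⊕ b) ⊕ (c ⊕ d) ⊜ (a ⊕ c) ⊕ (((c′ ⊕ b) ⊕ c) ⊕ d)) ≃-refl

  ⁻¹-swap-conj : ∀ a b → (a · b) ⁻¹ ≃ conj b (a ⁻¹) · b ⁻¹
  ⁻¹-swap-conj a b = ≃-trans (≡⇒≃ (reverse-++ a b)) (≃-sym (//-rightDividesʳ b (b ⁻¹ · a ⁻¹)))

⊆-⋆ˡ : ∀ {A B} → IsSubgroup B → A ⊆ (A ⋆ B)
⊆-⋆ˡ B-sub {w} a = w , ε , a , IsSubgroup.has-ε B-sub , sym (≃⇒≈ (identityʳ w))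

ʳ-isNormalSubgroupOfΔ⁺ : ∀ {H} → IsNormalSubgroupOfΔ⁺ H → IsNormalSubgroupOfΔ⁺ (H ʳ)
ʳ-isNormalSubgroupOfΔ⁺ {H} H◁ = record
  { subgroup = record
    { resp     = λ {u} {v} u≈v → resp≃ (conj-cong r₂ (≈⇒≃ {u} {v} u≈v))
    ; has-ε    = resp≃ (≃-sym (conj-ε r₂)) has-ε
    ; closed·  = λ {u} {v} hu hv → resp≃ (≃-sym (conj-· r₂ u v)) (closed· hu hv)
    ; closed⁻¹ = λ {u} hu → subst H (sym (conj-⁻¹ r₂ u)) (closed⁻¹ hu)
    }
  ; inΔ⁺   = λ {w} → Δ⁺-unreflect w ∘ inΔ⁺
  ; normal = λ {g} {k} g∈Δ⁺ hk →
      resp≃ (≃-sym (conj-conj r₂ g k)) (normal {reflect g} {reflect k} (Δ⁺-reflect g g∈Δ⁺) hk)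
  }
  where open NormalSubgroupOfΔ⁺ H◁

isNormalSubgroupOfΔ⁺ : ∀ {H} → IsHypermapSubgroup H → IsNormalSubgroupOfΔ⁺ H
isNormalSubgroupOfΔ⁺ H-hyp = record
  { subgroup = subgroup ; inΔ⁺ = λ {w} → inΔ⁺ {w} ; normal = λ {g} {k} → normal {g} {k} }
  where open IsHypermapSubgroup H-hyp

isHypermapSubgroup : ∀ {H} → IsNormalSubgroupOfΔ⁺ H → Σ ℕ (Index H Δ⁺) → IsHypermapSubgroup H
isHypermapSubgroup H◁ index = record
  { subgroup = subgroup ; inΔ⁺ = λ {w} → inΔ⁺ {w} ; normal = λ {g} {k} → normal {g} {k} ; finiteIndex = index }
  where open IsNormalSubgroupOfΔ⁺ H◁

-- Indices

⁻¹-anti-assoc : ∀ p q g → (p · q) ⁻¹ · g ≃ q ⁻¹ · (p ⁻¹ · g)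
⁻¹-anti-assoc p q g = ≃-trans (≡⇒≃ (cong (_· g) (reverse-++ p q))) (assoc (q ⁻¹) (p ⁻¹) g)

index-tower : ∀ {K M G a b} → IsSubgroup K → IsSubgroup M → IsSubgroup G → K ⊆ M → M ⊆ G →
              Index K M a → Index M G b → Index K G (b * a)
index-tower {K} {M} {G} {a} {b} K-sub M-sub G-sub K⊆M M⊆G (u , u∈M , u-inj , u-cov) (t , t∈G , t-inj , t-cov) =
  T , T∈G , T-inj , T-cov
  where
  module K = Subgroup K-sub
  module M = Subgroup M-sub

  rep : Fin b × Fin a → Word
  rep (i , j) = t i · u j

  T : Fin (b * a) → Word
  T = rep ∘ remQuot {b} a

  T∈G : ∀ k → G (T k)
  T∈G k = IsSubgroup.closed· G-sub (t∈G _) (M⊆G (u∈M _))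

  rep-inj : ∀ p p′ → K (rep p ⁻¹ · rep p′) → p ≡ p′
  -- Modulo M: t i ~ t i · u j ~ t i′ · u j′ ~ t i′.
  rep-inj (i , j) (i′ , j′) k with t-inj i i′
    (M.coset-trans {t i} {t i · u j} (M.coset-right (t i) (u∈M j))
      (M.coset-trans {t i · u j} {t i′ · u j′} (K⊆M k) (M.coset-sym {t i′} (M.coset-right (t i′) (u∈M j′)))))
  ... | refl = cong (i ,_) (u-inj j j′ (K.resp≃ cancel k))
    where
    cancel : (t i · u j) ⁻¹ · (t i · u j′) ≃ u j ⁻¹ · u j′
    cancel = ≃-trans (⁻¹-anti-assoc (t i) (u j) (t i · u j′)) (·-congˡ (u j ⁻¹) (\\-leftDividesʳ (t i) (u j′)))

  T-inj : ∀ k k′ → K (T k ⁻¹ · T k′) → k ≡ k′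
  T-inj k k′ kk = begin
    k                                   ≡⟨ combine-remQuot {b} a k ⟨
    uncurry combine (remQuot {b} a k)   ≡⟨ cong (uncurry combine) (rep-inj (remQuot a k) (remQuot a k′) kk) ⟩
    uncurry combine (remQuot {b} a k′)  ≡⟨ combine-remQuot {b} a k′ ⟩
    k′                                  ∎
    where open ≡-Reasoning

  T-cov : ∀ {g} → G g → Σ (Fin (b * a)) λ k → K (T k ⁻¹ · g)
  T-cov {g} g∈G with t-cov g∈G
  ... | i , m with u-cov m
  ... | j , k = combine i j ,
    subst (λ p → K (rep p ⁻¹ · g)) (sym (remQuot-combine i j)) (K.resp≃ (≃-sym (⁻¹-anti-assoc (t i) (u j) g)) k)

quotIso⇒index : ∀ {K G K′ G′ n} → IsSubgroup K′ → QuotIso K G K′ G′ → Index K′ G′ n → Index K G n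
quotIso⇒index {K} {G} {K′} {G′} {n} K′-sub (φ , φ∈G′ , φ-cosets , _ , φ-onto) (s , s∈G′ , s-inj , s-cov) =
  x , x∈G , x-inj , x-cov
  where
  open Subgroup K′-sub

  x : Fin n → Word
  x j = proj₁ (φ-onto (s∈G′ j))

  x∈G : ∀ j → G (x j)
  x∈G j = proj₁ (proj₂ (φ-onto (s∈G′ j)))

  φx~s : ∀ j → K′ (φ (x j) ⁻¹ · s j)
  φx~s j = proj₂ (proj₂ (φ-onto (s∈G′ j)))

  x-inj : ∀ i j → K (x i ⁻¹ · x j) → i ≡ j
  x-inj i j k = s-inj i j
    (coset-trans {s i} {φ (x i)} (coset-sym {φ (x i)} (φx~s i))
      (coset-trans {φ (x i)} {φ (x j)} (proj₁ (φ-cosets (x∈G i) (x∈G j)) k) (φx~s j)))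

  x-cov : ∀ {g} → G g → Σ (Fin n) λ j → K (x j ⁻¹ · g)
  x-cov {g} g∈G with s-cov (φ∈G′ g∈G)
  ... | j , k = j , proj₂ (φ-cosets (x∈G j) g∈G) (coset-trans {φ (x j)} {s j} (φx~s j) k)

index⇒dec : ∀ {K G n} → IsSubgroup K → G ε → Index K G n → ∀ {x} → G x → Dec (K x)
index⇒dec {K} K-sub ε∈G (t , _ , t-inj , t-cov) {x} x∈G with t-cov ε∈G | t-cov x∈G
... | i₀ , k₀ | i , k = map′
  (λ i≡i₀ → coset-member {t i} (subst (K ∘ t) (sym i≡i₀) t₀∈K) k)
  (λ x∈K → sym (t-inj i₀ i (member-coset {t i₀} t₀∈K (coset-member {x} x∈K (coset-sym {t i} k)))))
  (i ≟ i₀)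
  where
  open Subgroup K-sub
  t₀∈K : K (t i₀)
  t₀∈K = ⁻¹-member {t i₀} (resp≃ (identityʳ (t i₀ ⁻¹)) k₀)

module _ {K G : Pred} (K-sub : IsSubgroup K) (_~?_ : ∀ {x y} → G x → G y → Dec (K (x ⁻¹ · y))) where
  open Subgroup K-sub

  Covers : ∀ {n} → (Fin n → Word) → Word → Set
  Covers {n} t g = Σ (Fin n) λ i → K (t i ⁻¹ · g)

  Separated : ∀ {n} → (Fin n → Word) → Set
  Separated {n} s = ∀ i j → K (s i ⁻¹ · s j) → i ≡ j

  refine : ∀ n (t : Fin n → Word) → (∀ i → G (t i)) →
           ∀ N (s : Fin N → Word) → (∀ j → G (s j)) → Separated s →
           (∀ {g} → G g → Covers s g ⊎ Covers t g) → Σ ℕ (Index K G)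
  refine zero t _ N s s∈G s-sep cover = N , s , s∈G , s-sep , λ g∈G → fromCovers (cover g∈G)
    where
    fromCovers : ∀ {g} → Covers s g ⊎ Covers t g → Covers s g
    fromCovers (inj₁ c)       = c
    fromCovers (inj₂ (() , _))
  refine (suc n) t t∈G N s s∈G s-sep cover with any? (λ j → s∈G j ~? t∈G f0)
  ... | yes (j , s~t) = refine n (t ∘ fs) (t∈G ∘ fs) N s s∈G s-sep cover′
    where
    cover′ : ∀ {g} → G g → Covers s g ⊎ Covers (t ∘ fs) g
    cover′ g∈G with cover g∈G
    ... | inj₁ c            = inj₁ c
    ... | inj₂ (f0 , k)     = inj₁ (j , coset-trans {s j} {t f0} s~t k)
    ... | inj₂ (fs i , k)   = inj₂ (i , k)
  ... | no t-new = refine n (t ∘ fs) (t∈G ∘ fs) (suc N) s′ s′∈G s′-sep cover′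
    where
    s′ : Fin (suc N) → Word
    s′ f0     = t f0
    s′ (fs j) = s j
    s′∈G : ∀ j → G (s′ j)
    s′∈G f0     = t∈G f0
    s′∈G (fs j) = s∈G j
    s′-sep : Separated s′
    s′-sep f0     f0      _ = refl
    s′-sep f0     (fs j)  k = ⊥-elim (t-new (j , coset-sym {t f0} k))
    s′-sep (fs i) f0      k = ⊥-elim (t-new (i , k))
    s′-sep (fs i) (fs j)  k = cong fs (s-sep i j k)
    cover′ : ∀ {g} → G g → Covers s′ g ⊎ Covers (t ∘ fs) g
    cover′ g∈G with cover g∈G
    ... | inj₁ (j , k)      = inj₁ (fs j , k)
    ... | inj₂ (f0 , k)     = inj₁ (f0 , k)
    ... | inj₂ (fs i , k)   = inj₂ (i , k)

  covers⇒index : ∀ n (t : Fin n → Word) → (∀ i → G (t i)) → (∀ {g} → G g → Covers t g) → Σ ℕ (Index K G)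
  covers⇒index n t t∈G cover = refine n t t∈G 0 (λ ()) (λ ()) (λ ()) (inj₂ ∘ cover)

overgroup-index : ∀ {A G P n κ} → IsSubgroup A → IsSubgroup G → IsSubgroup P → A ⊆ G → G ⊆ P →
                  Index A P n → Index A G κ → Σ ℕ (Index G P)
overgroup-index {A} {G} {P} {n} A-sub G-sub P-sub A⊆G G⊆P A◃P@(t , t∈P , _ , t-cov) (s , s∈G , _ , s-cov) =
  covers⇒index G-sub _~?_ n t t∈P (λ g∈P → let (i , a) = t-cov g∈P in i , A⊆G a)
  where
  open IsSubgroup P-sub using (has-ε; closed·; closed⁻¹)
  open Subgroup G-sub using (coset-member)

  G? : ∀ {z} → P z → Dec (G z)
  G? {z} z∈P = map′
    (λ (j , a) → coset-member {s j} (s∈G j) (A⊆G a))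
    s-cov
    (any? λ j → index⇒dec A-sub has-ε A◃P (closed· (closed⁻¹ (G⊆P (s∈G j))) z∈P))

  _~?_ : ∀ {x y} → P x → P y → Dec (G (x ⁻¹ · y))
  x∈P ~? y∈P = G? (closed· (closed⁻¹ x∈P) y∈P)

-- Chirality and smoothness

quotIso-refl : ∀ {K G} → IsSubgroup K → QuotIso K G K G
quotIso-refl K-sub = (λ x → x) , (λ g → g) , (λ _ _ → (λ k → k) , (λ k → k)) ,
  (λ {x} {y} _ _ → coset-refl (x · y)) , (λ {y} y∈G → y , y∈G , coset-refl y)
  where open Subgroup K-sub

fixesCosets⇔power∈ : ∀ {H} → IsNormalSubgroupOfΔ⁺ H → ∀ g m → FixesCosets H g m ⇔ H (g ^ m)
fixesCosets⇔power∈ H◁ g m = mk⇔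
  (λ fixes → resp≃ (identityʳ (g ^ m)) (fixes {ε} (IsSubgroup.has-ε Δ⁺-isSubgroup)))
  (λ gᵐ∈H {x} x∈Δ⁺ → resp≃ (≡⇒≃ (++-assoc (x ⁻¹) (g ^ m) x)) (normal {x} {g ^ m} x∈Δ⁺ gᵐ∈H))
  where open NormalSubgroupOfΔ⁺ H◁

FixSameCosets : Pred → Pred → Word → Set
FixSameCosets A B g = ∀ m → FixesCosets A g m ⇔ FixesCosets B g m

permOrder-cong : ∀ {A B g} → FixSameCosets A B g → ∀ {m} → PermOrder A g m → PermOrder B g m
permOrder-cong same {m} (0<m , fixes , least) =
  0<m , (λ {x} → to (same m) (λ {y} → fixes {y}) {x}) ,
  λ m′ 0<m′ fixes′ → least m′ 0<m′ (λ {x} → from (same m′) (λ {y} → fixes′ {y}) {x})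

hasType-cong : ∀ {A B} → FixSameCosets A B (ρ · lam) → FixSameCosets A B ρ → FixSameCosets A B lam →
               ∀ {m n k} → HasType A m n k → HasType B m n k
hasType-cong {A} {B} ρλ ρ′ λ′ (o , p , q) =
  permOrder-cong {A} {B} ρλ o , permOrder-cong {A} {B} ρ′ p , permOrder-cong {A} {B} λ′ q

module _ {H : Pred} (H◁ : IsNormalSubgroupOfΔ⁺ H) where
  open NormalSubgroupOfΔ⁺ H◁

  reflect-coset : ∀ x y → reflect (x ⁻¹ · y) ≃ reflect x ⁻¹ · reflect y
  reflect-coset x y = ≃-trans (conj-· r₂ (x ⁻¹) y) (≡⇒≃ (cong (_· reflect y) (conj-⁻¹ r₂ x)))

  reflection-quotIso : QuotIso (H ∩ (H ʳ)) H H (H ⋆ (H ʳ))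
  reflection-quotIso = reflect , reflect∈HHʳ , cosets , homomorphic , onto
    where
    reflect∈HHʳ : ∀ {x} → H x → (H ⋆ (H ʳ)) (reflect x)
    reflect∈HHʳ {x} x∈H = ε , reflect x , has-ε , resp≃ (≃-sym (reflect-involutive x)) x∈H , refl

    cosets : ∀ {x y} → H x → H y →
             ((H ∩ (H ʳ)) (x ⁻¹ · y) → H (reflect x ⁻¹ · reflect y)) ×
             (H (reflect x ⁻¹ · reflect y) → (H ∩ (H ʳ)) (x ⁻¹ · y))
    cosets {x} {y} x∈H y∈H =
      (λ (_ , k) → resp≃ (reflect-coset x y) k) ,
      (λ k → member-coset {x} x∈H y∈H , resp≃ (≃-sym (reflect-coset x y)) k)

    homomorphic : ∀ {x y} → H x → H y → H (reflect (x · y) ⁻¹ · (reflect x · reflect y))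
    homomorphic {x} {y} _ _ =
      resp≃ (·-congʳ (⁻¹-cong (≃-sym (conj-· r₂ x y))) (reflect x · reflect y)) (coset-refl (reflect x · reflect y))

    onto : ∀ {y} → (H ⋆ (H ʳ)) y → Σ Word λ x → H x × H (reflect x ⁻¹ · y)
    onto {y} (a , b , a∈H , b∈Hʳ , y≈ab) = reflect b , b∈Hʳ , resp≃ conj≃ (normal {b} {a} b∈Δ⁺ a∈H)
      where
      b∈Δ⁺ : Δ⁺ b
      b∈Δ⁺ = Δ⁺-unreflect b (inΔ⁺ b∈Hʳ)
      conj≃ : conj b a ≃ reflect (reflect b) ⁻¹ · y
      conj≃ = begin
        b ⁻¹ · a · b                     ≈⟨ assoc (b ⁻¹) a b ⟩
        b ⁻¹ · (a · b)                   ≈⟨ ·-cong (⁻¹-cong (reflect-involutive b)) (≈⇒≃ {y} {a · b} y≈ab) ⟨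
        reflect (reflect b) ⁻¹ · y       ∎
        where open ≃-Reasoning ≃-setoid

  index-∩ʳ : ∀ {κ} → Index H (H ⋆ (H ʳ)) κ → Index (H ∩ (H ʳ)) H κ
  index-∩ʳ = quotIso⇒index {H ∩ (H ʳ)} subgroup reflection-quotIso

  power∈H⇒power∈Hʳ : ∀ g c → Δ⁺ c → reflect g ≃ conj c (g ⁻¹) → ∀ m → H (g ^ m) → (H ʳ) (g ^ m)
  power∈H⇒power∈Hʳ g c c∈Δ⁺ reflect-g m gᵐ∈H =
    resp≃ (≃-sym reflect-gᵐ) (normal {c} {(g ^ m) ⁻¹} c∈Δ⁺ (closed⁻¹ gᵐ∈H))
    where
    open ≃-Reasoning ≃-setoid
    reflect-gᵐ : reflect (g ^ m) ≃ conj c ((g ^ m) ⁻¹)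
    reflect-gᵐ = begin
      reflect (g ^ m)          ≈⟨ conj-^ r₂ g m ⟩
      reflect g ^ m            ≈⟨ ^-cong m reflect-g ⟩
      conj c (g ⁻¹) ^ m        ≈⟨ conj-^ c (g ⁻¹) m ⟨
      conj c ((g ⁻¹) ^ m)      ≈⟨ conj-cong c (⁻¹-^ g m) ⟩
      conj c ((g ^ m) ⁻¹)      ∎

  fixSameCosets-∩ʳ : ∀ g c → Δ⁺ c → reflect g ≃ conj c (g ⁻¹) → FixSameCosets H (H ∩ (H ʳ)) g
  fixSameCosets-∩ʳ g c c∈Δ⁺ reflect-g m = ⇔-trans (fixesCosets⇔power∈ H◁ g m)
    (⇔-trans (mk⇔ (λ gᵐ∈H → gᵐ∈H , power∈H⇒power∈Hʳ g c c∈Δ⁺ reflect-g m gᵐ∈H) proj₁)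
      (⇔-sym (fixesCosets⇔power∈ (∩-isNormalSubgroupOfΔ⁺ H◁ (ʳ-isNormalSubgroupOfΔ⁺ H◁)) g m)))

  -- r₂ inverts ρ = r₁r₂ and λ = r₂r₀, and maps ρλ = r₁r₀ to r₂r₁r₀r₂, the conjugate of (ρλ)⁻¹ by λ⁻¹.
  hasType-∩ʳ : ∀ m n k → HasType H m n k ⇔ HasType (H ∩ (H ʳ)) m n k
  hasType-∩ʳ m n k = mk⇔
    (hasType-cong {H} {H ∩ (H ʳ)} ρλ ρ′ λ′)
    (hasType-cong {H ∩ (H ʳ)} {H} (⇔-sym ∘ ρλ) (⇔-sym ∘ ρ′) (⇔-sym ∘ λ′))
    where
    ρλ = fixSameCosets-∩ʳ (ρ · lam) (lam ⁻¹) (divides 1 refl) (≈⇒≃ refl)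
    ρ′ = fixSameCosets-∩ʳ ρ ε (divides 0 refl) (≈⇒≃ refl)
    λ′ = fixSameCosets-∩ʳ lam ε (divides 0 refl) (≈⇒≃ refl)

theorem3 : (H : Pred) → IsHypermapSubgroup H → (κ : ℕ) → Index H (H ⋆ (H ʳ)) κ →
    IsHypermapSubgroup (H ∩ (H ʳ)) × IsHypermapSubgroup (H ⋆ (H ʳ)) ×
    ((H ∩ (H ʳ)) ⊆ H × NormalIn (H ∩ (H ʳ)) H × Index (H ∩ (H ʳ)) H κ
      × QuotIso (H ∩ (H ʳ)) H H (H ⋆ (H ʳ))) ×
    (H ⊆ (H ⋆ (H ʳ)) × NormalIn H (H ⋆ (H ʳ)) × Index H (H ⋆ (H ʳ)) κ
      × QuotIso H (H ⋆ (H ʳ)) H (H ⋆ (H ʳ))) ×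
    (∀ m n k → (HasType (H ∩ (H ʳ)) m n k → HasType H m n k)
      × (HasType H m n k → HasType (H ∩ (H ʳ)) m n k))
theorem3 H H-hyp κ [HHʳ:H] =
    isHypermapSubgroup I◁ (n * κ , index-tower I.subgroup H.subgroup Δ⁺-isSubgroup proj₁ H⊆Δ⁺ [H:I] [Δ⁺:H])
  , isHypermapSubgroup P◁ (overgroup-index H.subgroup P.subgroup Δ⁺-isSubgroup H⊆P (λ {w} → P.inΔ⁺ {w}) [Δ⁺:H] [HHʳ:H])
  , (proj₁ , normalIn {G = H} I◁ H⊆Δ⁺ , [H:I] , reflection-quotIso H◁)
  , (H⊆P , (λ {g} {k} → normalIn H◁ (λ {w} → P.inΔ⁺ {w}) {g} {k}) , [HHʳ:H] , quotIso-refl H.subgroup)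
  , λ m n k → from (hasType-∩ʳ H◁ m n k) , to (hasType-∩ʳ H◁ m n k)
  where
  open IsHypermapSubgroup H-hyp using (finiteIndex)
  n = proj₁ finiteIndex
  [Δ⁺:H] = proj₂ finiteIndex

  H◁ : IsNormalSubgroupOfΔ⁺ H
  H◁ = isNormalSubgroupOfΔ⁺ H-hyp
  Hʳ◁ : IsNormalSubgroupOfΔ⁺ (H ʳ)
  Hʳ◁ = ʳ-isNormalSubgroupOfΔ⁺ H◁
  I◁ : IsNormalSubgroupOfΔ⁺ (H ∩ (H ʳ))
  I◁ = ∩-isNormalSubgroupOfΔ⁺ H◁ Hʳ◁
  P◁ : IsNormalSubgroupOfΔ⁺ (H ⋆ (H ʳ))
  P◁ = ⋆-isNormalSubgroupOfΔ⁺ H◁ Hʳ◁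
  module H = IsNormalSubgroupOfΔ⁺ H◁
  module I = IsNormalSubgroupOfΔ⁺ I◁
  module P = IsNormalSubgroupOfΔ⁺ P◁

  H⊆Δ⁺ : H ⊆ Δ⁺
  H⊆Δ⁺ {w} = H.inΔ⁺ {w}
  H⊆P : H ⊆ (H ⋆ (H ʳ))
  H⊆P = ⊆-⋆ˡ (IsNormalSubgroupOfΔ⁺.subgroup Hʳ◁)
  [H:I] : Index (H ∩ (H ʳ)) H κ
  [H:I] = index-∩ʳ H◁ [HHʳ:H]
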